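{- Let $R$ be a commutative ring with unity. Let $C$ be a cycle on $n$ vertices $v_1,\dots,v_n$. For each $1\le i\le n$ let $T_i$ be a tree, possibly consisting of a single vertex. Let $G_1$ be the graph formed by pasting $T_1$ to $C$ at $v_1$, and for each $2\le i\le n$ let $G_i$ be the graph formed by pasting $T_i$ to $G_{i-1}$ at $v_i$ (so $V(T_i)\cap V(G_{i-1})=\{v_i\}$). Let $\alpha$ be an edge-labeling of $G_n$ over $R$, with each $G_j$ carrying the restricted labeling. Then $(G_n,\alpha)$ satisfies the Universal Difference Property if and only if both of the following hold: (i) $G_j$ (with the restricted labeling) satisfies the Universal Difference Property for all $1\le j\le n-1$; (ii) for every $u\in V(G_{n-1})$ and $w\in V(T_n)$, $$\bigcap_{P\in\mathcal{P}(u,w)}\alpha(P)=\Big(\bigcap_{P\in\mathcal{P}(u,v_n)}\alpha(P)\Big)+\Big(\bigcap_{P\in\mathcal{P}(v_n,w)}\alpha(P)\Big),$$ where $\mathcal{P}(a,b)$ denotes the set of paths from $a$ to $b$ in $G_n$.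
   Context: An edge-labeling of a graph over $R$ assigns to each edge an ideal of $R$. A spline on $(G,\alpha)$ is a function $\rho:V(G)\to R$ with $\rho(u)-\rho(v)\in\alpha(uv)$ for every edge $uv$. A path has no repeated vertices; $\alpha(P)$ is the sum of the ideals labeling the edges of the path $P$. Pasting two graphs at a vertex $z$ means taking their union where they share only the vertex $z$. An edge-labeled graph $(G,\alpha)$ satisfies the Universal Difference Property (UDP) if for every pair of vertices $u,w$ and every $x\in\bigcap_{P}\alpha(P)$ (intersection over all paths $P$ in $G$ from $u$ to $w$) there is a spline $\rho$ on $(G,\alpha)$ with $\rho(u)-\rho(w)=x$. -}

module Defs where

open import Level using (Level; _⊔_; suc; Lift)
open import Algebra.Bundles using (CommutativeRing)
open import Data.Nat as ℕ using (ℕ; _<ᵇ_)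
open import Data.Fin as Fin using (Fin; toℕ)
open import Data.Bool using (Bool; true; false; _∨_; T)
open import Data.Product using (Σ; Σ-syntax; ∃; ∃-syntax; _×_; _,_; proj₁)
open import Data.Sum using (_⊎_)
open import Data.List using (List; []; _∷_; length)
open import Data.List.Relation.Unary.Unique.Propositional using (Unique)
open import Relation.Binary.PropositionalEquality using (_≡_)
open import Relation.Nullary using (¬_)

module _ {c ℓ : Level} (R : CommutativeRing c ℓ) where
  open CommutativeRing R

  record Ideal : Set (suc (c ⊔ ℓ)) where
    field
      _∋_     : Carrier → Set (c ⊔ ℓ)
      ∋-resp  : ∀ {x y} → x ≈ y → _∋_ x → _∋_ y
      ∋-0     : _∋_ 0#
      ∋-+     : ∀ {x y} → _∋_ x → _∋_ y → _∋_ (x + y)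
      ∋-neg   : ∀ {x} → _∋_ x → _∋_ (- x)
      ∋-*     : ∀ r {x} → _∋_ x → _∋_ (r * x)

record Graph : Set₁ where
  field
    V   : Set
    Adj : V → V → Set

module _ (G : Graph) where
  open Graph G

  data Walk : V → V → Set where
    []  : ∀ {u} → Walk u u
    _∷_ : ∀ {u v w} → Adj u v → Walk v w → Walk u w

  vertices : ∀ {u w} → Walk u w → List V
  vertices {u} []      = u ∷ []
  vertices {u} (e ∷ p) = u ∷ vertices p

  Path : V → V → Set
  Path u w = Σ[ p ∈ Walk u w ] Unique (vertices p)

  IsSimple : Set
  IsSimple = (∀ {u v} → Adj u v → Adj v u) × (∀ {u} → ¬ Adj u u)

  Connected : Set
  Connected = ∀ u w → Path u w

  -- a cycle: distinct vertices x₀ … xₘ with m ≥ 2 (at least 3 vertices),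
  -- consecutive ones adjacent and xₘ adjacent to x₀; encoded as an edge x y
  -- together with a path from y back to x through at least 3 vertices
  HasCycle : Set
  HasCycle = Σ[ x ∈ V ] Σ[ y ∈ V ] Adj x y ×
             (Σ[ p ∈ Path y x ] 3 ℕ.≤ length (vertices (proj₁ p)))

  IsTree : Set
  IsTree = IsSimple × Connected × ¬ HasCycle

  Induced : (V → Bool) → Graph
  Induced P = record { V = Σ V (λ v → T (P v)) ; Adj = λ u v → Adj (proj₁ u) (proj₁ v) }

module _ {c ℓ : Level} (R : CommutativeRing c ℓ) where
  open CommutativeRing R
  open Ideal

  -- an edge-labeling of G: the ideal α u v labels the edge uv (only its
  -- values on adjacent pairs matter; symmetry is imposed where used)
  Labeling : Graph → Set (suc (c ⊔ ℓ))
  Labeling G = Graph.V G → Graph.V G → Ideal R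

  module _ (G : Graph) (α : Labeling G) where
    open Graph G

    -- membership in α(P) = sum of the ideals labeling the edges of the walk
    -- (the empty sum is the zero ideal)
    InWalkIdeal : ∀ {u w} → Walk G u w → Carrier → Set (c ⊔ ℓ)
    InWalkIdeal []                x = Lift c (x ≈ 0#)
    InWalkIdeal (_∷_ {u} {v} e p) x =
      ∃[ a ] ∃[ b ] (α u v ∋ a) × InWalkIdeal p b × x ≈ a + b

    InPathIdeal : ∀ {u w} → Path G u w → Carrier → Set (c ⊔ ℓ)
    InPathIdeal p = InWalkIdeal (proj₁ p)

    InAllPaths : V → V → Carrier → Set (c ⊔ ℓ)
    InAllPaths u w x = (p : Path G u w) → InPathIdeal p x

    IsSpline : (V → Carrier) → Set (c ⊔ ℓ)
    IsSpline ρ = ∀ {u v} → Adj u v → α u v ∋ (ρ u - ρ v)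

    UDP : Set (c ⊔ ℓ)
    UDP = ∀ u w x → InAllPaths u w x →
          ∃[ ρ ] IsSpline ρ × (ρ u - ρ w ≈ x)

  restrict : (G : Graph) (P : Graph.V G → Bool) → Labeling G → Labeling (Induced G P)
  restrict G P α u v = α (proj₁ u) (proj₁ v)

  SymLabeling : (G : Graph) → Labeling G → Set (c ⊔ ℓ)
  SymLabeling G α = ∀ u v x → α u v ∋ x → α v u ∋ x

-- Cycle vertices v₀ … v_{n-1} (0-indexed; the paper's
-- v_{i+1} is our vᵢ), tree Tᵢ on vertex set Fin (suc (k i)) with adjacency
-- Tr i, pasted at vᵢ along its vertex 0.
-- Vertex (i , s) of G_n is vertex s of Tᵢ; (i , 0) is the cycle vertex vᵢ.

TreeGraph : (m : ℕ) → (Fin m → Fin m → Set) → Graph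
TreeGraph m A = record { V = Fin m ; Adj = A }

CycAdj : (n : ℕ) → Fin n → Fin n → Set
CycAdj n i j = (toℕ j ≡ ℕ.suc (toℕ i)) ⊎ (toℕ i ≡ ℕ.suc (toℕ j))
             ⊎ (toℕ i ≡ 0 × ℕ.suc (toℕ j) ≡ n) ⊎ (toℕ j ≡ 0 × ℕ.suc (toℕ i) ≡ n)

module _ (n : ℕ) (k : Fin n → ℕ)
         (Tr : (i : Fin n) → Fin (ℕ.suc (k i)) → Fin (ℕ.suc (k i)) → Set) where

  GV : Set
  GV = Σ[ i ∈ Fin n ] Fin (ℕ.suc (k i))

  data GAdj : GV → GV → Set where
    cyc  : ∀ i j → CycAdj n i j → GAdj (i , Fin.zero) (j , Fin.zero)
    tree : ∀ i s t → Tr i s t → GAdj (i , s) (i , t)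

  Gfull : Graph
  Gfull = record { V = GV ; Adj = GAdj }

  inG : ℕ → GV → Bool
  inG j (i , Fin.zero)  = true
  inG j (i , Fin.suc _) = toℕ i <ᵇ j

  -- G_j (j = number of attached trees) as induced subgraph of G_n
  Gsub : ℕ → Graph
  Gsub j = Induced Gfull (inG j)

-- The root v of the last tree T is a cut vertex of G_n separating T from G_{n-1}, and both
-- G_{n-1} and T are retracts of G_n (collapse T onto v, resp. everything outside T onto v),
-- so splines on either pull back to splines on G_n.
-- (⇒) A path of G_n between two vertices of G_j stays in G_j, so the UDP restricts to G_j.
-- A spline ρ with ρ u - ρ w = x writes x = (ρ u - ρ v) + (ρ v - ρ w), the summands lying in
-- the respective path intersections; conversely every path from u into T passes through v.
-- (⇐) Pairs in G_{n-1} use the UDP of G_{n-1}, pairs in T the UDP of trees (extend a spline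
-- along a path by adding a constant on one side of an edge); for u ∈ G_{n-1}, w ∈ T, (ii)
-- splits x = a + b and the pulled-back splines for a and b add up.
module Submission where

open import Defs
open import Algebra.Bundles using (CommutativeRing)
import Algebra.Properties.AbelianGroup as AbelianGroupProperties
open import Data.Nat as ℕ using (ℕ; _≤_; _<_; _∸_; s≤s; _<ᵇ_)
import Data.Nat.Properties as ℕ
open import Data.Fin as Fin using (Fin; toℕ; zero; suc)
import Data.Fin.Properties as Fin
open import Data.Bool using (Bool; true; false; T; if_then_else_)
open import Data.Bool.Properties using (T-irrelevant)
open import Data.Unit using (tt)
open import Data.Product using (Σ-syntax; ∃-syntax; _×_; _,_; proj₁; proj₂; swap)
open import Data.Sum using (_⊎_; inj₁; inj₂)
open import Data.List using ([]; _∷_; _∷ʳ_; length; map)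
open import Data.List.Membership.Propositional using (_∈_; _∉_)
import Data.List.Membership.DecPropositional as DecMembership
open import Data.List.Relation.Binary.Subset.Propositional using (_⊆_)
open import Data.List.Relation.Unary.Any using (here; there)
open import Data.List.Relation.Unary.All as All using (All; []; _∷_)
open import Data.List.Relation.Unary.All.Properties using (¬Any⇒All¬; All¬⇒¬Any)
open import Data.List.Relation.Unary.AllPairs using ([]; _∷_)
open import Data.List.Relation.Unary.Unique.Propositional using (Unique)
import Data.List.Relation.Unary.Unique.Propositional.Properties as Unique
open import Relation.Binary.Definitions using (DecidableEquality)
import Relation.Binary.PropositionalEquality as ≡
open ≡ using (_≡_; _≢_; refl; cong; cong₂; subst; subst₂)
open import Relation.Nullary using (¬_; yes; no; does)
open import Relation.Nullary.Decidable using (T?; dec-true; dec-false; does-⇔; _×-dec_)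
open import Data.Empty using (⊥-elim)
open import Function using (_∘_; id; case_of_)
open import Function.Bundles using (_⇔_; mk⇔; Equivalence)
open import Level using (_⊔_; lift)

module RingLemmas {c ℓ} (R : CommutativeRing c ℓ) where
  open CommutativeRing R
  open import Relation.Binary.Reasoning.Setoid setoid
  open AbelianGroupProperties +-abelianGroup public
    using (ε⁻¹≈ε; ⁻¹-∙-comm; ⁻¹-anti-homo‿-; ⁻¹-involutive)

  [x+y]-[u+v]≈[x-u]+[y-v] : ∀ x y u v → (x + y) - (u + v) ≈ (x - u) + (y - v)
  [x+y]-[u+v]≈[x-u]+[y-v] x y u v = begin
    (x + y) + - (u + v)    ≈⟨ +-congˡ (⁻¹-∙-comm u v) ⟨
    (x + y) + (- u + - v)  ≈⟨ +-assoc x y (- u + - v) ⟩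
    x + (y + (- u + - v))  ≈⟨ +-congˡ (+-comm y (- u + - v)) ⟩
    x + ((- u + - v) + y)  ≈⟨ +-congˡ (+-assoc (- u) (- v) y) ⟩
    x + (- u + (- v + y))  ≈⟨ +-assoc x (- u) (- v + y) ⟨
    (x - u) + (- v + y)    ≈⟨ +-congˡ (+-comm (- v) y) ⟩
    (x - u) + (y - v)      ∎

  [x+z]-[y+z]≈x-y : ∀ x y z → (x + z) - (y + z) ≈ x - y
  [x+z]-[y+z]≈x-y x y z = begin
    (x + z) - (y + z)      ≈⟨ [x+y]-[u+v]≈[x-u]+[y-v] x z y z ⟩
    (x - y) + (z - z)      ≈⟨ +-congˡ (-‿inverseʳ z) ⟩
    (x - y) + 0#           ≈⟨ +-identityʳ (x - y) ⟩
    x - y                  ∎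

  [x-y]+[y-z]≈x-z : ∀ x y z → (x - y) + (y - z) ≈ x - z
  [x-y]+[y-z]≈x-z x y z = begin
    (x - y) + (y - z)      ≈⟨ [x+y]-[u+v]≈[x-u]+[y-v] x y y z ⟨
    (x + y) - (y + z)      ≈⟨ +-congˡ (-‿cong (+-comm y z)) ⟩
    (x + y) - (z + y)      ≈⟨ [x+z]-[y+z]≈x-y x z y ⟩
    x - z                  ∎

  [x+[a-[x-y]]]-y≈a : ∀ x y a → (x + (a - (x - y))) - y ≈ a
  [x+[a-[x-y]]]-y≈a x y a = begin
    (x + (a - (x - y))) - y    ≈⟨ +-congʳ (+-comm x _) ⟩
    ((a - (x - y)) + x) - y    ≈⟨ +-assoc _ x (- y) ⟩
    (a - (x - y)) + (x - y)    ≈⟨ +-assoc a _ (x - y) ⟩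
    a + (- (x - y) + (x - y))  ≈⟨ +-congˡ (-‿inverseˡ (x - y)) ⟩
    a + 0#                     ≈⟨ +-identityʳ a ⟩
    a                          ∎

module Walks (G : Graph) where
  open Graph G

  infixr 5 _++ʷ_
  _++ʷ_ : ∀ {a b c} → Walk G a b → Walk G b c → Walk G a c
  []      ++ʷ q = q
  (e ∷ p) ++ʷ q = e ∷ (p ++ʷ q)

  head-∈ : ∀ {a b} (p : Walk G a b) → a ∈ vertices G p
  head-∈ []      = here refl
  head-∈ (e ∷ p) = here refl

  last-∈ : ∀ {a b} (p : Walk G a b) → b ∈ vertices G p
  last-∈ []      = here refl
  last-∈ (e ∷ p) = there (last-∈ p)

  ∈-++ʷ⁺ˡ : ∀ {a b c} (p : Walk G a b) (q : Walk G b c) → vertices G p ⊆ vertices G (p ++ʷ q)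
  ∈-++ʷ⁺ˡ []      q (here refl) = head-∈ q
  ∈-++ʷ⁺ˡ (e ∷ p) q (here refl) = here refl
  ∈-++ʷ⁺ˡ (e ∷ p) q (there z∈p) = there (∈-++ʷ⁺ˡ p q z∈p)

  ∈-++ʷ⁺ʳ : ∀ {a b c} (p : Walk G a b) (q : Walk G b c) → vertices G q ⊆ vertices G (p ++ʷ q)
  ∈-++ʷ⁺ʳ []      q z∈q = z∈q
  ∈-++ʷ⁺ʳ (e ∷ p) q z∈q = there (∈-++ʷ⁺ʳ p q z∈q)

  ∈-++ʷ⁻ : ∀ {a b c z} (p : Walk G a b) (q : Walk G b c) →
           z ∈ vertices G (p ++ʷ q) → z ∈ vertices G p ⊎ z ∈ vertices G q
  ∈-++ʷ⁻ []      q z∈       = inj₂ z∈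
  ∈-++ʷ⁻ (e ∷ p) q (here eq) = inj₁ (here eq)
  ∈-++ʷ⁻ (e ∷ p) q (there z∈) with ∈-++ʷ⁻ p q z∈
  ... | inj₁ z∈p = inj₁ (there z∈p)
  ... | inj₂ z∈q = inj₂ z∈q

  Unique-++ʷ⁻ : ∀ {a b c} (p : Walk G a b) (q : Walk G b c) → Unique (vertices G (p ++ʷ q)) →
                Unique (vertices G p) × Unique (vertices G q)
  Unique-++ʷ⁻ []      q uq = [] ∷ [] , uq
  Unique-++ʷ⁻ (e ∷ p) q (a∉ ∷ u) with Unique-++ʷ⁻ p q u
  ... | up , uq = All.tabulate (All.lookup a∉ ∘ ∈-++ʷ⁺ˡ p q) ∷ up , uq

  splitAt : ∀ {a b c} (p : Walk G a b) → c ∈ vertices G p →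
            Σ[ p₁ ∈ Walk G a c ] Σ[ p₂ ∈ Walk G c b ] p₁ ++ʷ p₂ ≡ p
  splitAt []      (here refl) = [] , [] , refl
  splitAt (e ∷ p) (here refl) = [] , e ∷ p , refl
  splitAt (e ∷ p) (there c∈p) with splitAt p c∈p
  ... | p₁ , p₂ , refl = e ∷ p₁ , p₂ , refl

  module _ (_≟_ : DecidableEquality V) where
    open DecMembership _≟_ using (_∈?_)

    toPath : ∀ {a b} (p : Walk G a b) → Σ[ q ∈ Path G a b ] vertices G (proj₁ q) ⊆ vertices G p
    toPath []       = ([] , [] ∷ []) , id
    toPath {a} (e ∷ p) with toPath p
    ... | (q , uq) , q⊆p with a ∈? vertices G q
    ...   | yes a∈q = let q₁ , q₂ , q₁q₂≡q = splitAt q a∈q in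
      (q₂ , proj₂ (Unique-++ʷ⁻ q₁ q₂ (subst (Unique ∘ vertices G) (≡.sym q₁q₂≡q) uq))) ,
      there ∘ q⊆p ∘ subst (λ r → _ ∈ vertices G r) q₁q₂≡q ∘ ∈-++ʷ⁺ʳ q₁ q₂
    ...   | no a∉q = (e ∷ q , ¬Any⇒All¬ _ a∉q ∷ uq) ,
      λ { (here refl) → here refl ; (there z∈q) → there (q⊆p z∈q) }

  module _ (Adj-sym : ∀ {u v} → Adj u v → Adj v u) where

    reverse : ∀ {a b} → Walk G a b → Walk G b a
    reverse []      = []
    reverse (e ∷ p) = reverse p ++ʷ (Adj-sym e ∷ [])

    vertices-snoc : ∀ {a b c} (p : Walk G a b) (e : Adj b c) →
                    vertices G (p ++ʷ (e ∷ [])) ≡ vertices G p ∷ʳ c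
    vertices-snoc []          e = refl
    vertices-snoc {a} (f ∷ p) e = cong (a ∷_) (vertices-snoc p e)

    ∈-reverse⁻ : ∀ {a b} (p : Walk G a b) → vertices G (reverse p) ⊆ vertices G p
    ∈-reverse⁻ []      z∈ = z∈
    ∈-reverse⁻ (e ∷ p) z∈ with ∈-++ʷ⁻ (reverse p) (Adj-sym e ∷ []) z∈
    ... | inj₁ z∈p            = there (∈-reverse⁻ p z∈p)
    ... | inj₂ (here refl)    = there (head-∈ p)
    ... | inj₂ (there (here refl)) = here refl

    Unique-reverse : ∀ {a b} (p : Walk G a b) → Unique (vertices G p) → Unique (vertices G (reverse p))
    Unique-reverse []      u          = u
    Unique-reverse (e ∷ p) (a∉p ∷ up) =
      subst Unique (≡.sym (vertices-snoc (reverse p) (Adj-sym e)))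
        (Unique.++⁺ (Unique-reverse p up) ([] ∷ [])
          λ { (a∈ , here refl) → All¬⇒¬Any a∉p (∈-reverse⁻ p a∈) })

module Splines {c ℓ} (R : CommutativeRing c ℓ) (G : Graph) (α : Labeling R G) where
  open Graph G
  open Walks G
  open CommutativeRing R renaming (refl to ≈-refl)
  open RingLemmas R
  open Ideal

  SplineFor : V → V → Carrier → Set (c ⊔ ℓ)
  SplineFor u w x = ∃[ ρ ] IsSpline R G α ρ × (ρ u - ρ w ≈ x)

  x-x∈ : ∀ {u v} x → α u v ∋ (x - x)
  x-x∈ {u} {v} x = ∋-resp (α u v) (sym (-‿inverseʳ x)) (∋-0 (α u v))

  InWalkIdeal-resp : ∀ {a b} (p : Walk G a b) {x y} → x ≈ y →
                     InWalkIdeal R G α p x → InWalkIdeal R G α p y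
  InWalkIdeal-resp []      x≈y (lift x≈0)             = lift (trans (sym x≈y) x≈0)
  InWalkIdeal-resp (e ∷ p) x≈y (a , b , a∈ , b∈ , x≈) = a , b , a∈ , b∈ , trans (sym x≈y) x≈

  InWalkIdeal-++ : ∀ {a b d} (p : Walk G a b) (q : Walk G b d) {x y} →
                   InWalkIdeal R G α p x → InWalkIdeal R G α q y → InWalkIdeal R G α (p ++ʷ q) (x + y)
  InWalkIdeal-++ []      q {x} {y} (lift x≈0) y∈ =
    InWalkIdeal-resp q (sym (trans (+-congʳ x≈0) (+-identityˡ y))) y∈
  InWalkIdeal-++ (e ∷ p) q {y = y} (a , b , a∈ , b∈ , x≈) y∈ =
    a , b + y , a∈ , InWalkIdeal-++ p q b∈ y∈ , trans (+-congʳ x≈) (+-assoc a b y)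

  InWalkIdeal-++⁻ : ∀ {a b d} (p : Walk G a b) (q : Walk G b d) {x} → InWalkIdeal R G α (p ++ʷ q) x →
                    ∃[ y ] ∃[ z ] InWalkIdeal R G α p y × InWalkIdeal R G α q z × x ≈ y + z
  InWalkIdeal-++⁻ []      q {x} x∈ = 0# , x , lift ≈-refl , x∈ , sym (+-identityˡ x)
  InWalkIdeal-++⁻ (e ∷ p) q (a , b , a∈ , b∈ , x≈) with InWalkIdeal-++⁻ p q b∈
  ... | y , z , y∈ , z∈ , b≈ =
    a + y , z , (a , y , a∈ , y∈ , ≈-refl) , z∈ , trans x≈ (trans (+-congˡ b≈) (sym (+-assoc a y z)))

  InWalkIdeal-neg : ∀ {a b} (p : Walk G a b) {x} → InWalkIdeal R G α p x → InWalkIdeal R G α p (- x)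
  InWalkIdeal-neg []      (lift x≈0)             = lift (trans (-‿cong x≈0) ε⁻¹≈ε)
  InWalkIdeal-neg (e ∷ p) (a , b , a∈ , b∈ , x≈) =
    - a , - b , ∋-neg (α _ _) a∈ , InWalkIdeal-neg p b∈ , trans (-‿cong x≈) (sym (⁻¹-∙-comm a b))

  spline-∈-InWalkIdeal : ∀ {ρ} → IsSpline R G α ρ → ∀ {a b} (p : Walk G a b) →
                         InWalkIdeal R G α p (ρ a - ρ b)
  spline-∈-InWalkIdeal {ρ} ρ-spline {a} []    = lift (-‿inverseʳ (ρ a))
  spline-∈-InWalkIdeal {ρ} ρ-spline {a} {b} (_∷_ {v = v} e p) =
    ρ a - ρ v , ρ v - ρ b , ρ-spline e , spline-∈-InWalkIdeal ρ-spline p ,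
    sym ([x-y]+[y-z]≈x-z (ρ a) (ρ v) (ρ b))

  spline-∈-InAllPaths : ∀ {ρ} → IsSpline R G α ρ → ∀ u w → InAllPaths R G α u w (ρ u - ρ w)
  spline-∈-InAllPaths ρ-spline u w (p , _) = spline-∈-InWalkIdeal ρ-spline p

  IsSpline-+ : ∀ {ρ σ} → IsSpline R G α ρ → IsSpline R G α σ → IsSpline R G α (λ v → ρ v + σ v)
  IsSpline-+ ρ-spline σ-spline e =
    ∋-resp (α _ _) (sym ([x+y]-[u+v]≈[x-u]+[y-v] _ _ _ _)) (∋-+ (α _ _) (ρ-spline e) (σ-spline e))

  InAllPathsVia : V → V → V → Carrier → Set (c ⊔ ℓ)
  InAllPathsVia u v w x = ∃[ a ] ∃[ b ] InAllPaths R G α u v a × InAllPaths R G α v w b × x ≈ a + b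

  UDP⇒InAllPathsVia : UDP R G α → ∀ {u w x} v → InAllPaths R G α u w x → InAllPathsVia u v w x
  UDP⇒InAllPathsVia udp {u} {w} {x} v x∈ with udp u w x x∈
  ... | ρ , ρ-spline , ρu-ρw≈x =
    ρ u - ρ v , ρ v - ρ w , spline-∈-InAllPaths ρ-spline u v , spline-∈-InAllPaths ρ-spline v w ,
    trans (sym ρu-ρw≈x) (sym ([x-y]+[y-z]≈x-z (ρ u) (ρ v) (ρ w)))

  InAllPathsVia-cut : ∀ {u v w x} → (∀ (p : Path G u w) → v ∈ vertices G (proj₁ p)) →
                      InAllPathsVia u v w x → InAllPaths R G α u w x
  InAllPathsVia-cut through (a , b , a∈ , b∈ , x≈a+b) (p , up) with splitAt p (through (p , up))
  ... | p₁ , p₂ , refl with Unique-++ʷ⁻ p₁ p₂ up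
  ...   | up₁ , up₂ =
    InWalkIdeal-resp p (sym x≈a+b) (InWalkIdeal-++ p₁ p₂ (a∈ (p₁ , up₁)) (b∈ (p₂ , up₂)))

  SplineFor-sym : ∀ {u w x} → SplineFor w u (- x) → SplineFor u w x
  SplineFor-sym {u} {w} {x} (ρ , ρ-spline , ρw-ρu≈-x) =
    ρ , ρ-spline ,
    trans (sym (⁻¹-anti-homo‿- (ρ w) (ρ u))) (trans (-‿cong ρw-ρu≈-x) (⁻¹-involutive x))

  module _ (Adj-sym : ∀ {u v} → Adj u v → Adj v u) (α-sym : SymLabeling R G α) where

    InWalkIdeal-reverse⁻ : ∀ {a b} (p : Walk G a b) {x} →
                           InWalkIdeal R G α (reverse Adj-sym p) x → InWalkIdeal R G α p x
    InWalkIdeal-reverse⁻ []      x∈ = x∈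
    InWalkIdeal-reverse⁻ (e ∷ p) x∈
      with InWalkIdeal-++⁻ (reverse Adj-sym p) (Adj-sym e ∷ []) x∈
    ... | y , z , y∈ , (a , b , a∈ , lift b≈0 , z≈) , x≈ =
      a , y , α-sym _ _ a a∈ , InWalkIdeal-reverse⁻ p y∈ ,
      trans x≈ (trans (+-congˡ (trans z≈ (trans (+-congˡ b≈0) (+-identityʳ a)))) (+-comm y a))

    InAllPaths-reverse : ∀ {u w x} → InAllPaths R G α u w x → InAllPaths R G α w u (- x)
    InAllPaths-reverse x∈ (p , up) =
      InWalkIdeal-neg p (InWalkIdeal-reverse⁻ p (x∈ (reverse Adj-sym p , Unique-reverse Adj-sym p up)))

module WalkMaps {G H : Graph} (f : Graph.V G → Graph.V H)
                (f-Adj : ∀ {u v} → Graph.Adj G u v → Graph.Adj H (f u) (f v)) where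

  mapWalk : ∀ {a b} → Walk G a b → Walk H (f a) (f b)
  mapWalk []      = []
  mapWalk (e ∷ p) = f-Adj e ∷ mapWalk p

  vertices-mapWalk : ∀ {a b} (p : Walk G a b) → vertices H (mapWalk p) ≡ map f (vertices G p)
  vertices-mapWalk []      = refl
  vertices-mapWalk (e ∷ p) = cong (f _ ∷_) (vertices-mapWalk p)

  mapPath : (∀ {a b} → f a ≡ f b → a ≡ b) → ∀ {a b} → Path G a b → Path H (f a) (f b)
  mapPath f-injective (p , up) =
    mapWalk p , subst Unique (≡.sym (vertices-mapWalk p)) (Unique.map⁺ f-injective up)

  module _ {c ℓ} (R : CommutativeRing c ℓ) (α : Labeling R H) where

    InWalkIdeal-mapWalk⁺ : ∀ {a b} (p : Walk G a b) {x} →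
      InWalkIdeal R G (λ u v → α (f u) (f v)) p x → InWalkIdeal R H α (mapWalk p) x
    InWalkIdeal-mapWalk⁺ []      x∈                     = x∈
    InWalkIdeal-mapWalk⁺ (e ∷ p) (a , b , a∈ , b∈ , x≈) =
      a , b , a∈ , InWalkIdeal-mapWalk⁺ p b∈ , x≈

    InWalkIdeal-mapWalk⁻ : ∀ {a b} (p : Walk G a b) {x} →
      InWalkIdeal R H α (mapWalk p) x → InWalkIdeal R G (λ u v → α (f u) (f v)) p x
    InWalkIdeal-mapWalk⁻ []      x∈                     = x∈
    InWalkIdeal-mapWalk⁻ (e ∷ p) (a , b , a∈ , b∈ , x≈) =
      a , b , a∈ , InWalkIdeal-mapWalk⁻ p b∈ , x≈

PathConvex : (G : Graph) → (Graph.V G → Bool) → Set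
PathConvex G P = ∀ {u w} (p : Path G u w) → T (P u) → T (P w) → All (T ∘ P) (vertices G (proj₁ p))

module InducedSubgraph {c ℓ} (R : CommutativeRing c ℓ) (G : Graph) (P : Graph.V G → Bool)
                       (α : Labeling R G) where
  open Graph G
  open Walks G using (head-∈)
  open WalkMaps {Induced G P} {G} proj₁ id

  liftWalk : ∀ {u w} (p : Walk G u w) → All (T ∘ P) (vertices G p) → (u∈ : T (P u)) (w∈ : T (P w)) →
             Σ[ q ∈ Walk (Induced G P) (u , u∈) (w , w∈) ] mapWalk q ≡ p
  liftWalk []      _        u∈ w∈ rewrite T-irrelevant u∈ w∈ = [] , refl
  liftWalk (e ∷ p) (_ ∷ p∈) u∈ w∈ with liftWalk p p∈ (All.lookup p∈ (head-∈ p)) w∈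
  ... | q , q↦p = e ∷ q , cong (e ∷_) q↦p

  UDP-induced : PathConvex G P → UDP R G α → UDP R (Induced G P) (restrict R G P α)
  UDP-induced convex udp (u , u∈) (w , w∈) x x∈ with udp u w x x∈G
    where
    x∈G : InAllPaths R G α u w x
    x∈G (p , up) with liftWalk p (convex (p , up) u∈ w∈) u∈ w∈
    ... | q , refl =
      InWalkIdeal-mapWalk⁺ R α q (x∈ (q , Unique.map⁻ (subst Unique (vertices-mapWalk q) up)))
  ... | ρ , ρ-spline , ρu-ρw≈x = ρ ∘ proj₁ , ρ-spline , ρu-ρw≈x

module Retraction {c ℓ} (R : CommutativeRing c ℓ) {G H : Graph} (α : Labeling R G)
  (ι : Graph.V H → Graph.V G) (ι-Adj : ∀ {a b} → Graph.Adj H a b → Graph.Adj G (ι a) (ι b))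
  (π : Graph.V G → Graph.V H) (π∘ι : ∀ a → π (ι a) ≡ a)
  (π-Adj : ∀ {u v} → Graph.Adj G u v →
           π u ≡ π v ⊎ (Graph.Adj H (π u) (π v) × ι (π u) ≡ u × ι (π v) ≡ v)) where
  open CommutativeRing R
  open Splines R
  open WalkMaps {H} {G} ι ι-Adj
  open Ideal

  ι*α : Labeling R H
  ι*α a b = α (ι a) (ι b)

  ι-injective : ∀ {a b} → ι a ≡ ι b → a ≡ b
  ι-injective {a} {b} ιa≡ιb = ≡.trans (≡.sym (π∘ι a)) (≡.trans (cong π ιa≡ιb) (π∘ι b))

  InAllPaths-ι : ∀ {a b x} → InAllPaths R G α (ι a) (ι b) x → InAllPaths R H ι*α a b x
  InAllPaths-ι x∈ p = InWalkIdeal-mapWalk⁻ R α (proj₁ p) (x∈ (mapPath ι-injective p))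

  IsSpline-∘π : ∀ {σ} → IsSpline R H ι*α σ → IsSpline R G α (σ ∘ π)
  IsSpline-∘π {σ} σ-spline {u} {v} e with π-Adj e
  ... | inj₁ πu≡πv = subst (λ z → α u v ∋ (σ (π u) - σ z)) πu≡πv (x-x∈ G α (σ (π u)))
  ... | inj₂ (e′ , ιπu≡u , ιπv≡v) =
    subst₂ (λ a b → α a b ∋ _) ιπu≡u ιπv≡v (σ-spline e′)

  SplineFor-ι : ∀ {a b x} → SplineFor H ι*α a b x → SplineFor G α (ι a) (ι b) x
  SplineFor-ι {a} {b} {x} (σ , σ-spline , σa-σb≈x) =
    σ ∘ π , IsSpline-∘π σ-spline ,
    subst₂ (λ a′ b′ → σ a′ - σ b′ ≈ x) (≡.sym (π∘ι a)) (≡.sym (π∘ι b)) σa-σb≈x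

module Trees (Γ : Graph) (_≟_ : DecidableEquality (Graph.V Γ)) (Γ-tree : IsTree Γ) where
  open Graph Γ
  open Walks Γ
  open DecMembership _≟_ using (_∈?_)

  Adj-sym : ∀ {u v} → Adj u v → Adj v u
  Adj-sym = proj₁ (proj₁ Γ-tree)

  Adj-irrefl : ∀ {u} → ¬ Adj u u
  Adj-irrefl = proj₂ (proj₁ Γ-tree)

  path : ∀ u w → Path Γ u w
  path = proj₁ (proj₂ Γ-tree)

  Unique-edge : ∀ {u v} → Adj u v → Unique (u ∷ v ∷ [])
  Unique-edge e = ((λ { refl → Adj-irrefl e }) ∷ []) ∷ [] ∷ []

  paths-unique : ∀ {a b} (p q : Walk Γ a b) → Unique (vertices Γ p) → Unique (vertices Γ q) →
                 vertices Γ p ≡ vertices Γ q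
  paths-unique []      []      _          _          = refl
  paths-unique []      (f ∷ q) _          (a∉q ∷ _)  = ⊥-elim (All¬⇒¬Any a∉q (last-∈ q))
  paths-unique (e ∷ p) []      (a∉p ∷ _)  _          = ⊥-elim (All¬⇒¬Any a∉p (last-∈ p))
  paths-unique {a} (_∷_ {v = v} e p) (_∷_ {v = v′} f q) (a∉p ∷ up) (a∉q ∷ uq) with v ≟ v′
  ... | yes refl = cong (a ∷_) (paths-unique p q up uq)
  ... | no v≢v′  = ⊥-elim (proj₂ (proj₂ Γ-tree) cycle)
    where
    -- a → v′ ⇝ v → a, with v′ ⇝ v obtained from q followed by p reversed
    back : Σ[ r ∈ Path Γ v′ v ] vertices Γ (proj₁ r) ⊆ vertices Γ (q ++ʷ reverse Adj-sym p)
    back = toPath _≟_ (q ++ʷ reverse Adj-sym p)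

    a∉back : a ∉ vertices Γ (proj₁ (proj₁ back))
    a∉back a∈ with ∈-++ʷ⁻ q (reverse Adj-sym p) (proj₂ back a∈)
    ... | inj₁ a∈q = All¬⇒¬Any a∉q a∈q
    ... | inj₂ a∈p = All¬⇒¬Any a∉p (∈-reverse⁻ Adj-sym p a∈p)

    3≤length : ∀ {x y z} (g : Adj x y) (r : Walk Γ y z) → y ≢ z → 3 ℕ.≤ length (vertices Γ (g ∷ r))
    3≤length g []          y≢z = ⊥-elim (y≢z refl)
    3≤length g (h ∷ [])    _   = s≤s (s≤s (s≤s ℕ.z≤n))
    3≤length g (h ∷ i ∷ r) _   = s≤s (s≤s (s≤s ℕ.z≤n))

    cycle : HasCycle Γ
    cycle = let (r , ur) , _ = back in
      v , a , Adj-sym e , (f ∷ r , ¬Any⇒All¬ _ a∉back ∷ ur) , 3≤length f r (v≢v′ ∘ ≡.sym)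

  adjacent-paths : ∀ {v v′ r} (e : Adj v v′) (p : Walk Γ v r) (p′ : Walk Γ v′ r) →
    Unique (vertices Γ p) → Unique (vertices Γ p′) →
    vertices Γ p ≡ v ∷ vertices Γ p′ ⊎ vertices Γ p′ ≡ v′ ∷ vertices Γ p
  adjacent-paths {v} {v′} e p p′ up up′ with v′ ∈? vertices Γ p | v ∈? vertices Γ p′
  ... | no v′∉p  | _       = inj₂ (paths-unique p′ (Adj-sym e ∷ p) up′ (¬Any⇒All¬ _ v′∉p ∷ up))
  ... | yes _    | no v∉p′ = inj₁ (paths-unique p (e ∷ p′) up (¬Any⇒All¬ _ v∉p′ ∷ up′))
  ... | yes v′∈p | yes v∈p′ = ⊥-elim (v′∉p p up v′∈p)
    where
    -- the part of p after v′ is a path v′ ⇝ r avoiding v, yet it has the vertices of p′ ∋ v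
    v′∉p : (p : Walk Γ v _) → Unique (vertices Γ p) → v′ ∉ vertices Γ p
    v′∉p []      _           (here refl)  = Adj-irrefl e
    v′∉p (g ∷ p) _           (here refl)  = Adj-irrefl e
    v′∉p (g ∷ p) (v∉p ∷ up) (there v′∈p) with splitAt p v′∈p
    ... | p₁ , p₂ , refl with proj₂ (Unique-++ʷ⁻ p₁ p₂ up)
    ...   | up₂ = All¬⇒¬Any v∉p (∈-++ʷ⁺ʳ p₁ p₂ v∈p₂)
      where
      v∈p₂ : v ∈ vertices Γ p₂
      v∈p₂ = subst (v ∈_) (≡.sym (paths-unique p₂ p′ up₂ up′)) v∈p′

  module Side {s r} (d : Adj s r) where

    toR : ∀ v → Walk Γ v r
    toR v = proj₁ (path v r)

    toR-unique : ∀ v → Unique (vertices Γ (toR v))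
    toR-unique v = proj₂ (path v r)

    side : V → Bool
    side v = does (s ∈? vertices Γ (toR v))

    side-s : side s ≡ true
    side-s = dec-true (s ∈? _) (head-∈ (toR s))

    side-r : side r ≡ false
    side-r = dec-false (s ∈? _) λ s∈ →
      case subst (s ∈_) (paths-unique (toR r) [] (toR-unique r) ([] ∷ [])) s∈ of λ where
        (here refl) → Adj-irrefl d

    side-step : ∀ {v v′} → Adj v v′ → vertices Γ (toR v) ≡ v ∷ vertices Γ (toR v′) →
                ¬ (v ≡ s × v′ ≡ r) → side v ≡ side v′
    side-step {v} {v′} e p≡vp′ ¬sr =
      does-⇔ (mk⇔ to (subst (s ∈_) (≡.sym p≡vp′) ∘ there)) (s ∈? _) (s ∈? _)
      where
      to : s ∈ vertices Γ (toR v) → s ∈ vertices Γ (toR v′)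
      to s∈p with subst (s ∈_) p≡vp′ s∈p
      ... | there s∈p′ = s∈p′
      ... | here refl with s ∈? vertices Γ (toR v′)
      ...   | yes s∈p′ = s∈p′
      ...   | no s∉p′ = ⊥-elim (¬sr (refl , v′≡r))
        where
        sr-path : vertices Γ (e ∷ toR v′) ≡ s ∷ r ∷ []
        sr-path =
          paths-unique (e ∷ toR v′) (d ∷ []) (¬Any⇒All¬ _ s∉p′ ∷ toR-unique v′) (Unique-edge d)

        v′≡r : v′ ≡ r
        v′≡r with subst (v′ ∈_) sr-path (there (head-∈ (toR v′)))
        ... | here v′≡s         = ⊥-elim (Adj-irrefl (subst (Adj s) v′≡s e))
        ... | there (here v′≡r) = v′≡r

    side-edge : ∀ {v v′} → Adj v v′ →
                side v ≡ side v′ ⊎ (v ≡ s × v′ ≡ r) ⊎ (v ≡ r × v′ ≡ s)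
    side-edge {v} {v′} e with (v ≟ s) ×-dec (v′ ≟ r) | (v ≟ r) ×-dec (v′ ≟ s)
    ... | yes vv′≡sr | _          = inj₂ (inj₁ vv′≡sr)
    ... | no _       | yes vv′≡rs = inj₂ (inj₂ vv′≡rs)
    ... | no vv′≢sr  | no vv′≢rs with adjacent-paths e (toR v) (toR v′) (toR-unique v) (toR-unique v′)
    ...   | inj₁ p≡vp′  = inj₁ (side-step e p≡vp′ vv′≢sr)
    ...   | inj₂ p′≡v′p = inj₁ (≡.sym (side-step (Adj-sym e) p′≡v′p (vv′≢rs ∘ swap)))

    side-walk : ∀ {a b} (p : Walk Γ a b) → s ∉ vertices Γ p → side a ≡ side b
    side-walk []      _ = refl
    side-walk (e ∷ p) s∉ with side-edge e
    ... | inj₁ same             = ≡.trans same (side-walk p (s∉ ∘ there))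
    ... | inj₂ (inj₁ (refl , _)) = ⊥-elim (s∉ (here refl))
    ... | inj₂ (inj₂ (_ , refl)) = ⊥-elim (s∉ (there (head-∈ p)))

  module _ {ℓ₁ ℓ₂} (R : CommutativeRing ℓ₁ ℓ₂) (β : Labeling R Γ) (β-sym : SymLabeling R Γ β)
    where
    open CommutativeRing R renaming (refl to ≈-refl)
    open RingLemmas R
    open Splines R Γ β
    open Ideal

    path-spline : ∀ {s t} (p : Walk Γ s t) → Unique (vertices Γ p) →
                  ∀ {y} → InWalkIdeal R Γ β p y → SplineFor s t y
    path-spline [] _ (lift y≈0) = (λ _ → 0#) , (λ _ → x-x∈ 0#) , trans (-‿inverseʳ 0#) (sym y≈0)
    path-spline {s} {t} (_∷_ {v = r} d p) (s∉p ∷ up) {y} (a , y′ , a∈ , y′∈ , y≈a+y′)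
      with path-spline p up y′∈
    ... | σ , σ-spline , σr-σt≈y′ = τ , τ-spline , τs-τt≈y
      where
      open Side d

      -- shifting σ on the s-side of the edge d by c corrects the difference across d to a
      c : Carrier
      c = a - (σ s - σ r)

      τ : V → Carrier
      τ v = if side v then σ v + c else σ v

      τ-same-side : ∀ {v v′} → side v ≡ side v′ → τ v - τ v′ ≈ σ v - σ v′
      τ-same-side {v} {v′} same rewrite same with side v′
      ... | true  = [x+z]-[y+z]≈x-y (σ v) (σ v′) c
      ... | false = ≈-refl

      τs-τr≈a : τ s - τ r ≈ a
      τs-τr≈a rewrite side-s | side-r = [x+[a-[x-y]]]-y≈a (σ s) (σ r) a

      τ-spline : IsSpline R Γ β τ
      τ-spline e with side-edge e
      ... | inj₁ same                 = ∋-resp (β _ _) (sym (τ-same-side same)) (σ-spline e)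
      ... | inj₂ (inj₁ (refl , refl)) = ∋-resp (β s r) (sym τs-τr≈a) a∈
      ... | inj₂ (inj₂ (refl , refl)) =
        β-sym s r _ (∋-resp (β s r) (trans (-‿cong (sym τs-τr≈a)) (⁻¹-anti-homo‿- (τ s) (τ r)))
                                    (∋-neg (β s r) a∈))

      τs-τt≈y : τ s - τ t ≈ y
      τs-τt≈y = begin
        τ s - τ t                  ≈⟨ [x-y]+[y-z]≈x-z (τ s) (τ r) (τ t) ⟨
        (τ s - τ r) + (τ r - τ t)  ≈⟨ +-cong τs-τr≈a (τ-same-side (side-walk p (All¬⇒¬Any s∉p))) ⟩
        a + (σ r - σ t)            ≈⟨ +-congˡ σr-σt≈y′ ⟩
        a + y′                     ≈⟨ y≈a+y′ ⟨
        y                          ∎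
        where open import Relation.Binary.Reasoning.Setoid setoid

    tree-UDP : UDP R Γ β
    tree-UDP s t y y∈ = path-spline (proj₁ (path s t)) (proj₂ (path s t)) (y∈ (path s t))

module PastedTrees (n : ℕ) (k : Fin n → ℕ)
  (Tr : (i : Fin n) → Fin (ℕ.suc (k i)) → Fin (ℕ.suc (k i)) → Set)
  (trees : ∀ i → IsTree (TreeGraph (ℕ.suc (k i)) (Tr i))) where

  G : Graph
  G = Gfull n k Tr

  open Walks G

  CycAdj-sym : ∀ {i j} → CycAdj n i j → CycAdj n j i
  CycAdj-sym (inj₁ j≡1+i)               = inj₂ (inj₁ j≡1+i)
  CycAdj-sym (inj₂ (inj₁ i≡1+j))        = inj₁ i≡1+j
  CycAdj-sym (inj₂ (inj₂ (inj₁ wrap)))  = inj₂ (inj₂ (inj₂ wrap))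
  CycAdj-sym (inj₂ (inj₂ (inj₂ wrap)))  = inj₂ (inj₂ (inj₁ wrap))

  Adj-sym : ∀ {u v} → GAdj n k Tr u v → GAdj n k Tr v u
  Adj-sym (cyc i j c)    = cyc j i (CycAdj-sym c)
  Adj-sym (tree i s t e) = tree i t s (proj₁ (proj₁ (trees i)) e)

  root-∈ : ∀ j {i s w} (p : Walk G (i , s) w) → T (inG n k Tr j w) → ¬ T (toℕ i <ᵇ j) →
           (i , zero) ∈ vertices G p
  root-∈ j {s = zero}  p                  _  _   = head-∈ p
  root-∈ j {s = suc s} []                 w∈ i≮j = ⊥-elim (i≮j w∈)
  root-∈ j {s = suc s} (tree _ _ _ _ ∷ p) w∈ i≮j = there (root-∈ j p w∈ i≮j)

  root-∈-path : ∀ j {u i t} → T (inG n k Tr j u) → ¬ T (toℕ i <ᵇ j) →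
                (p : Path G u (i , t)) → (i , zero) ∈ vertices G (proj₁ p)
  root-∈-path j u∈ i≮j (p , _) = ∈-reverse⁻ Adj-sym p (root-∈ j (reverse Adj-sym p) u∈ i≮j)

  -- A path leaves G_j only by entering a tree T_i (i ≥ j) at its root, and it cannot
  -- come back to G_j without passing that root again.
  inG-step : ∀ j {u v w} (e : GAdj n k Tr u v) (p : Walk G v w) → u ∉ vertices G p →
             T (inG n k Tr j u) → T (inG n k Tr j w) → T (inG n k Tr j v)
  inG-step j (cyc _ _ _)                p _   _  _  = tt
  inG-step j (tree _ _ zero _)          p _   _  _  = tt
  inG-step j (tree _ (suc _) (suc _) _) p _   u∈ _  = u∈
  inG-step j (tree i zero (suc _) _)    p u∉p _  w∈ with T? (toℕ i <ᵇ j)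
  ... | yes i<j = i<j
  ... | no i≮j  = ⊥-elim (u∉p (root-∈ j p w∈ i≮j))

  inG-convex : ∀ j → PathConvex G (inG n k Tr j)
  inG-convex j ([] , _)               u∈ _  = u∈ ∷ []
  inG-convex j (e ∷ p , up@(_ ∷ up′)) u∈ w∈ =
    u∈ ∷ inG-convex j (p , up′) (inG-step j e p (Unique.Unique[x∷xs]⇒x∉xs up) u∈ w∈) w∈

  module LastTree (L : Fin n) (L-last : toℕ L ≡ n ∸ 1) where

    Base : Graph
    Base = Gsub n k Tr (n ∸ 1)

    TreeL : Graph
    TreeL = TreeGraph (ℕ.suc (k L)) (Tr L)

    L-not-below : ¬ T (toℕ L <ᵇ n ∸ 1)
    L-not-below L<n-1 = ℕ.<-irrefl L-last (ℕ.<ᵇ⇒< _ _ L<n-1)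

    below-L : ∀ {i} → i ≢ L → T (toℕ i <ᵇ n ∸ 1)
    below-L {i} i≢L = ℕ.<⇒<ᵇ (ℕ.≤∧≢⇒< i≤n-1 i≢n-1)
      where
      i≤n-1 : toℕ i ≤ n ∸ 1
      i≤n-1 = subst (toℕ i ≤_) (ℕ.pred[m∸n]≡m∸[1+n] n 0) (Fin.toℕ≤pred[n] i)

      i≢n-1 : toℕ i ≢ n ∸ 1
      i≢n-1 i≡n-1 = i≢L (Fin.toℕ-injective (≡.trans i≡n-1 (≡.sym L-last)))

    inBase : ∀ {i} → i ≢ L → ∀ s → T (inG n k Tr (n ∸ 1) (i , s))
    inBase i≢L zero    = tt
    inBase i≢L (suc s) = below-L i≢L

    toBase : GV n k Tr → Graph.V Base
    toBase (i , zero)  = (i , zero) , tt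
    toBase (i , suc s) with i Fin.≟ L
    ... | yes _  = (i , zero) , tt
    ... | no i≢L = (i , suc s) , below-L i≢L

    toBase-ι : ∀ v → toBase (proj₁ v) ≡ v
    toBase-ι ((i , zero) , tt) = refl
    toBase-ι ((i , suc s) , i<n-1) with i Fin.≟ L
    ... | yes refl = ⊥-elim (L-not-below i<n-1)
    ... | no _     = cong ((i , suc s) ,_) (T-irrelevant _ _)

    toBase-L : ∀ t → toBase (L , t) ≡ ((L , zero) , tt)
    toBase-L zero    = refl
    toBase-L (suc t) with L Fin.≟ L
    ... | yes _  = refl
    ... | no L≢L = ⊥-elim (L≢L refl)

    ι-toBase : ∀ {i} → i ≢ L → ∀ s → proj₁ (toBase (i , s)) ≡ (i , s)
    ι-toBase i≢L zero        = refl
    ι-toBase {i} i≢L (suc s) with i Fin.≟ L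
    ... | yes i≡L = ⊥-elim (i≢L i≡L)
    ... | no _    = refl

    toBase-Adj : ∀ {u v} → GAdj n k Tr u v →
                 toBase u ≡ toBase v ⊎
                 (Graph.Adj Base (toBase u) (toBase v) × proj₁ (toBase u) ≡ u × proj₁ (toBase v) ≡ v)
    toBase-Adj (cyc i j c) = inj₂ (cyc i j c , refl , refl)
    toBase-Adj (tree i s t e) with i Fin.≟ L
    ... | yes refl = inj₁ (≡.trans (toBase-L s) (≡.sym (toBase-L t)))
    ... | no i≢L   = inj₂ (subst₂ (GAdj n k Tr) (≡.sym (ι-toBase i≢L s)) (≡.sym (ι-toBase i≢L t))
                                  (tree i s t e) ,
                           ι-toBase i≢L s , ι-toBase i≢L t)

    toL : GV n k Tr → Fin (ℕ.suc (k L))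
    toL (i , s) with i Fin.≟ L
    ... | yes refl = s
    ... | no _     = zero

    toL-ι : ∀ s → toL (L , s) ≡ s
    toL-ι s with L Fin.≟ L
    ... | yes refl = refl
    ... | no L≢L   = ⊥-elim (L≢L refl)

    toL-off : ∀ {i} → i ≢ L → ∀ s → toL (i , s) ≡ zero
    toL-off {i} i≢L s with i Fin.≟ L
    ... | yes i≡L = ⊥-elim (i≢L i≡L)
    ... | no _    = refl

    toL-root : ∀ i → toL (i , zero) ≡ zero
    toL-root i with i Fin.≟ L
    ... | yes refl = refl
    ... | no _     = refl

    toL-Adj : ∀ {u v} → GAdj n k Tr u v →
              toL u ≡ toL v ⊎ (Tr L (toL u) (toL v) × (L , toL u) ≡ u × (L , toL v) ≡ v)
    toL-Adj (cyc i j _) = inj₁ (≡.trans (toL-root i) (≡.sym (toL-root j)))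
    toL-Adj (tree i s t e) with i Fin.≟ L
    ... | yes refl = inj₂ (e , refl , refl)
    ... | no _     = inj₁ refl

  module _ {c ℓ} (R : CommutativeRing c ℓ) (α : Labeling R G) (α-sym : SymLabeling R G α)
           (L : Fin n) (L-last : toℕ L ≡ n ∸ 1) where
    open CommutativeRing R hiding (zero)
    open RingLemmas R
    open Splines R G α
    open LastTree L L-last
    module ViaBase = Retraction R α proj₁ id toBase toBase-ι toBase-Adj
    module ViaL    = Retraction R α (L ,_) (tree L _ _) toL toL-ι toL-Adj

    TreeL-UDP : UDP R TreeL ViaL.ι*α
    TreeL-UDP = Trees.tree-UDP TreeL Fin._≟_ (trees L) R _ (λ a b → α-sym (L , a) (L , b))

    module _ (Base-UDP : UDP R Base (restrict R G (inG n k Tr (n ∸ 1)) α))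
             (via-root : ∀ u → T (inG n k Tr (n ∸ 1) u) → ∀ t x →
                         InAllPaths R G α u (L , t) x → InAllPathsVia u (L , zero) (L , t) x) where

      base-to-L : ∀ {i} → i ≢ L → ∀ s t x →
                  InAllPaths R G α (i , s) (L , t) x → SplineFor (i , s) (L , t) x
      base-to-L {i} i≢L s t x x∈ with via-root (i , s) (inBase i≢L s) t x x∈
      ... | a , b , a∈ , b∈ , x≈a+b
        with Base-UDP ((i , s) , inBase i≢L s) ((L , zero) , tt) a (ViaBase.InAllPaths-ι a∈)
           | TreeL-UDP zero t b (ViaL.InAllPaths-ι b∈)
      ... | σ , σ-spline , σ≈a | τ , τ-spline , τ≈b =
        ρ , IsSpline-+ {σ ∘ toBase} {τ ∘ toL} (ViaBase.IsSpline-∘π {σ} σ-spline)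
                                              (ViaL.IsSpline-∘π {τ} τ-spline) ,
        ρ≈x
        where
        open import Relation.Binary.Reasoning.Setoid setoid

        ρ : GV n k Tr → Carrier
        ρ v = σ (toBase v) + τ (toL v)

        û : Graph.V Base
        û = (i , s) , inBase i≢L s

        ρ≈x : ρ (i , s) - ρ (L , t) ≈ x
        ρ≈x = begin
          ρ (i , s) - ρ (L , t)
            ≈⟨ [x+y]-[u+v]≈[x-u]+[y-v] _ _ _ _ ⟩
          (σ (toBase (i , s)) - σ (toBase (L , t))) + (τ (toL (i , s)) - τ (toL (L , t)))
            ≡⟨ cong₂ (λ b l → (σ b - σ (toBase (L , t))) + (τ l - τ (toL (L , t))))
                     (toBase-ι û) (toL-off i≢L s) ⟩
          (σ û - σ (toBase (L , t))) + (τ zero - τ (toL (L , t)))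
            ≡⟨ cong₂ (λ b l → (σ û - σ b) + (τ zero - τ l)) (toBase-L t) (toL-ι t) ⟩
          (σ û - σ ((L , zero) , tt)) + (τ zero - τ t)
            ≈⟨ +-cong σ≈a τ≈b ⟩
          a + b
            ≈⟨ x≈a+b ⟨
          x ∎

      UDP-pasted : UDP R G α
      UDP-pasted (i , s) (i′ , s′) x x∈ with i Fin.≟ L | i′ Fin.≟ L
      ... | no i≢L   | no i′≢L  = ViaBase.SplineFor-ι
        (Base-UDP ((i , s) , inBase i≢L s) ((i′ , s′) , inBase i′≢L s′) x (ViaBase.InAllPaths-ι x∈))
      ... | no i≢L   | yes refl = base-to-L i≢L s s′ x x∈
      ... | yes refl | no i′≢L  =
        SplineFor-sym (base-to-L i′≢L s′ s (- x) (InAllPaths-reverse Adj-sym α-sym x∈))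
      ... | yes refl | yes refl = ViaL.SplineFor-ι (TreeL-UDP s s′ x (ViaL.InAllPaths-ι x∈))

theorem2p9 : ∀ {c ℓ} (R : CommutativeRing c ℓ) (n : ℕ) → 3 ≤ n →
    (k : Fin n → ℕ) (Tr : (i : Fin n) → Fin (ℕ.suc (k i)) → Fin (ℕ.suc (k i)) → Set) →
    (∀ i → IsTree (TreeGraph (ℕ.suc (k i)) (Tr i))) →
    (α : Labeling R (Gfull n k Tr)) → SymLabeling R (Gfull n k Tr) α →
    UDP R (Gfull n k Tr) α ⇔
      ((∀ j → 1 ≤ j → j < n →
          UDP R (Gsub n k Tr j) (restrict R (Gfull n k Tr) (inG n k Tr j) α))
       ×
       (∀ u → T (inG n k Tr (n ∸ 1) u) → ∀ (i : Fin n) t → toℕ i ≡ n ∸ 1 →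
          ∀ x → InAllPaths R (Gfull n k Tr) α u (i , t) x ⇔
                (∃[ a ] ∃[ b ] InAllPaths R (Gfull n k Tr) α u (i , zero) a
                             × InAllPaths R (Gfull n k Tr) α (i , zero) (i , t) b
                             × CommutativeRing._≈_ R x (CommutativeRing._+_ R a b))))
theorem2p9 R (ℕ.suc (ℕ.suc (ℕ.suc m))) (s≤s (s≤s (s≤s _))) k Tr trees α α-sym = mk⇔
  (λ udp →
    (λ j _ _ → InducedSubgraph.UDP-induced R G (inG n k Tr j) α (inG-convex j) udp) ,
    λ u u∈ i t i-last x →
      mk⇔ (UDP⇒InAllPathsVia G α udp (i , zero))
          (InAllPathsVia-cut G α (root-∈-path (n ∸ 1) u∈ (LastTree.L-not-below i i-last))))
  (λ (sub-UDP , root-cut) →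
    UDP-pasted R α α-sym L L-last (sub-UDP (n ∸ 1) (s≤s ℕ.z≤n) (ℕ.n<1+n _))
      λ u u∈ t x → Equivalence.to (root-cut u u∈ L t L-last x))
  where
  n : ℕ
  n = ℕ.suc (ℕ.suc (ℕ.suc m))
  open PastedTrees n k Tr trees
  open Splines R
  L : Fin n
  L = Fin.fromℕ (n ∸ 1)
  L-last : toℕ L ≡ n ∸ 1
  L-last = Fin.toℕ-fromℕ (n ∸ 1)
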